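{- Let $G$ be a finite commutative group with $|G|=q$, and let $A_1,A_2\subset G$ be standard sets. Then \[ \delta(A_1\cup A_2)\ge\delta(A_1)\,\delta(A_2). \]
   Context: $G$ is written additively. A set $A\subset G$ is a standard set if $A=-A$ and $0\in A$. For a standard set $A$, $\Delta(A)=\max\{|B|:B\subset G,\ (B-B)\cap A=\{0\}\}$ and $\delta(A)=\Delta(A)/q$. -}

module Defs where

open import Level using (0ℓ)
open import Algebra.Bundles using (AbelianGroup)
open import Data.Nat using (ℕ; _*_; _≤_)
open import Data.Fin using (Fin)
open import Data.List using (List; length)
open import Data.List.Membership.Propositional using (_∈_)
open import Data.List.Relation.Unary.AllPairs using (AllPairs)
open import Data.Product using (Σ; _×_; ∃; ∃-syntax)
open import Data.Sum using (_⊎_)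
open import Relation.Nullary using (¬_)
open import Function.Bundles using (Inverse)
import Relation.Binary.PropositionalEquality as ≡

-- A finite commutative group of order q: an abelian group (additively
-- written in the paper; the stdlib record uses _∙_, ε, _⁻¹) together with
-- a bijection (of setoids) between Fin q and G.
record FiniteAbelianGroup : Set₁ where
  field
    abGroup : AbelianGroup 0ℓ 0ℓ
  open AbelianGroup abGroup public
  field
    q     : ℕ
    enum  : Inverse (≡.setoid (Fin q)) setoid

module _ (G : FiniteAbelianGroup) where
  open FiniteAbelianGroup G

  record Subset : Set₁ where
    field
      mem     : Carrier → Set
      respect : ∀ {x y} → x ≈ y → mem x → mem y
  open Subset public

  _∪_ : Subset → Subset → Subset
  A ∪ B = record { mem = λ x → mem A x ⊎ mem B x ; respect = resp }
    where
    resp : ∀ {x y} → x ≈ y → mem A x ⊎ mem B x → mem A y ⊎ mem B y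
    resp e (Data.Sum.inj₁ a) = Data.Sum.inj₁ (respect A e a)
    resp e (Data.Sum.inj₂ b) = Data.Sum.inj₂ (respect B e b)

  record Standard (A : Subset) : Set where
    field
      symm    : ∀ x → mem A x → mem A (x ⁻¹)
      symm⁻   : ∀ x → mem A (x ⁻¹) → mem A x
      zero∈   : mem A ε

  -- difference b - b' = b ∙ b' ⁻¹ is the library's _-_ from AbelianGroup

  record FinSubset : Set where
    field
      elems    : List Carrier
      distinct : AllPairs (λ x y → ¬ (x ≈ y)) elems
  open FinSubset public

  -- (B - B) ∩ A = {0}
  Avoids : Subset → FinSubset → Set
  Avoids A B =
    (∀ {b b'} → b ∈ elems B → b' ∈ elems B → mem A (b - b') → (b - b') ≈ ε)
    × (∃[ b ] ∃[ b' ] (b ∈ elems B × b' ∈ elems B × mem A (b - b') × (b - b') ≈ ε))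

  IsΔ : Subset → ℕ → Set
  IsΔ A n =
    (∃[ B ] (Avoids A B × length (elems B) ≡.≡ n))
    × (∀ B → Avoids A B → length (elems B) ≤ n)

-- Take Δ-optimal B₁ for A₁ and B₂ for A₂ and sort the |B₁||B₂| pairs (b₁ , b₂) by
-- their difference b₁ - b₂; one of the q classes has at least |B₁||B₂|/q elements.
-- Within a class b₁ - b₁' = b₂ - b₂', so the first coordinates of a class are
-- distinct and every difference between them avoids both A₁ (through B₁) and
-- A₂ (through B₂): they form a set admissible for A₁ ∪ A₂, of size at most Δ(A₁ ∪ A₂).

module Submission where

open import Level using (0ℓ)
open import Defs
open import Data.Nat using (ℕ; zero; suc; _+_; _*_; _≤_; _<_; z≤n)
open import Data.Nat.Properties using (_≟_; ≤-trans; ≤-reflexive; +-mono-≤; +-suc; ≤-pred; ≤∧≢⇒<; *-comm; module ≤-Reasoning)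
open import Data.Fin using (toℕ)
open import Data.Fin.Properties using (toℕ<n; toℕ-injective)
open import Data.List using (List; []; _∷_; length; filter; map; cartesianProduct)
open import Data.List.Properties using (length-map; length-++)
open import Data.List.Membership.Propositional using (_∈_)
open import Data.List.Membership.Propositional.Properties using (∈-map⁻; ∈-cartesianProduct⁻)
open import Data.List.Relation.Unary.All as All using (All; []; _∷_)
import Data.List.Relation.Unary.All.Properties as All
open import Data.List.Relation.Unary.AllPairs as AllPairs using (AllPairs; []; _∷_)
import Data.List.Relation.Unary.AllPairs.Properties as AllPairs
open import Data.List.Relation.Unary.Any using (here)
import Data.List.Relation.Unary.Unique.Setoid.Properties as Unique
open import Data.List.Relation.Binary.Sublist.Propositional.Properties using (filter⁺; filter-⊆; length-mono-≤)
open import Data.Product using (_×_; _,_; proj₁; proj₂)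
open import Data.Sum using (inj₁; inj₂)
open import Relation.Nullary using (¬_; yes; no)
open import Relation.Unary using (Pred; Decidable)
open import Relation.Unary.Properties using (∁?)
open import Relation.Binary.PropositionalEquality as ≡ using (_≡_)
open import Function.Bundles using (Injection; Inverse)
open import Function.Properties.Inverse using (Inverse⇒Injection)
import Function.Construct.Symmetry as Symmetry
import Algebra.Properties.AbelianGroup as AbelianGroupProperties
import Algebra.Properties.CommutativeSemigroup as CommutativeSemigroupProperties
import Relation.Binary.Reasoning.Setoid as SetoidReasoning

length-filter+filter-∁ : ∀ {A : Set} {P : Pred A 0ℓ} (P? : Decidable P) (xs : List A) →
  length xs ≡ length (filter P? xs) + length (filter (∁? P?) xs)
length-filter+filter-∁ P? [] = ≡.refl
length-filter+filter-∁ P? (x ∷ xs) with P? x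
... | yes _ = ≡.cong suc (length-filter+filter-∁ P? xs)
... | no _  = ≡.trans (≡.cong suc (length-filter+filter-∁ P? xs)) (≡.sym (+-suc _ _))

length-cartesianProduct : ∀ {A B : Set} (xs : List A) (ys : List B) →
  length (cartesianProduct xs ys) ≡ length xs * length ys
length-cartesianProduct [] ys = ≡.refl
length-cartesianProduct (x ∷ xs) ys = ≡.trans (length-++ (map (x ,_) ys))
  (≡.cong₂ _+_ (length-map (x ,_) ys) (length-cartesianProduct xs ys))

AllPairs-map-All : ∀ {A : Set} {P : A → Set} {R S : A → A → Set} →
  (∀ {x y} → P x → P y → R x y → S x y) → ∀ {xs} → All P xs → AllPairs R xs → AllPairs S xs
AllPairs-map-All R⇒S [] [] = []
AllPairs-map-All R⇒S (px ∷ pxs) (rxs ∷ rs) =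
  All.zipWith (λ (py , rxy) → R⇒S px py rxy) (pxs , rxs) ∷ AllPairs-map-All R⇒S pxs rs

module _ {A : Set} (label : A → ℕ) where

  fibre : ℕ → List A → List A
  fibre i = filter (λ a → label a ≟ i)

  fibres-bound-length : ∀ q n xs → All (λ a → label a < q) xs →
    (∀ i → length (fibre i xs) ≤ n) → length xs ≤ q * n
  fibres-bound-length zero    n []      _         _ = z≤n
  fibres-bound-length zero    n (_ ∷ _) (() ∷ _)  _
  fibres-bound-length (suc k) n xs      labels<q fibres≤n = begin
    length xs                          ≡⟨ length-filter+filter-∁ (λ a → label a ≟ k) xs ⟩
    length (fibre k xs) + length rest  ≤⟨ +-mono-≤ (fibres≤n k)
                                            (fibres-bound-length k n rest labels<k fibres-of-rest≤n) ⟩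
    n + k * n                          ∎
    where
    open ≤-Reasoning
    rest = filter (∁? (λ a → label a ≟ k)) xs
    labels<k : All (λ a → label a < k) rest
    labels<k = All.zipWith (λ (a<1+k , a≢k) → ≤∧≢⇒< (≤-pred a<1+k) a≢k)
      (All.filter⁺ _ labels<q , All.all-filter _ xs)
    fibres-of-rest≤n : ∀ i → length (fibre i rest) ≤ n
    fibres-of-rest≤n i =
      ≤-trans (length-mono-≤ (filter⁺ _ _ (λ { ≡.refl p → p }) (filter-⊆ _ xs))) (fibres≤n i)

module _ (G : FiniteAbelianGroup) where
  open FiniteAbelianGroup G
  open AbelianGroupProperties abGroup
  open CommutativeSemigroupProperties commutativeSemigroup using (interchange)

  Separates : Subset G → List Carrier → Set
  Separates A bs = ∀ {b b'} → b ∈ bs → b' ∈ bs → mem A (b - b') → (b - b') ≈ ε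

  separates⇒avoids : ∀ {A B b} → mem A ε → b ∈ elems B → Separates A (elems B) → Avoids G A B
  separates⇒avoids {A} {b = b} 0∈A b∈B sep =
    sep , b , b , b∈B , b∈B , respect A (sym b-b≈ε) 0∈A , b-b≈ε
    where b-b≈ε = x≈y⇒x∙y⁻¹≈ε refl

  enum-from-injective : ∀ {x y} → Inverse.from enum x ≡ Inverse.from enum y → x ≈ y
  enum-from-injective = Injection.injective (Inverse⇒Injection (Symmetry.inverse enum))

  difference-interchange : ∀ a b c d → (a - b) - (c - d) ≈ (a - c) - (b - d)
  difference-interchange a b c d = begin
    (a - b) - (c - d)        ≈⟨ ∙-congˡ (⁻¹-anti-homo‿- c d) ⟩
    (a ∙ b ⁻¹) ∙ (d ∙ c ⁻¹)  ≈⟨ interchange a (b ⁻¹) d (c ⁻¹) ⟩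
    (a ∙ d) ∙ (b ⁻¹ ∙ c ⁻¹)  ≈⟨ ∙-congˡ (comm (b ⁻¹) (c ⁻¹)) ⟩
    (a ∙ d) ∙ (c ⁻¹ ∙ b ⁻¹)  ≈⟨ interchange a (c ⁻¹) d (b ⁻¹) ⟨
    (a ∙ c ⁻¹) ∙ (d ∙ b ⁻¹)  ≈⟨ ∙-congˡ (⁻¹-anti-homo‿- b d) ⟨
    (a - c) - (b - d)        ∎
    where open SetoidReasoning setoid

  x-y≈u-v⇒x-u≈y-v : ∀ {a b c d} → a - b ≈ c - d → a - c ≈ b - d
  x-y≈u-v⇒x-u≈y-v {a} {b} {c} {d} a-b≈c-d = x∙y⁻¹≈ε⇒x≈y _ _ (begin
    (a - c) - (b - d)  ≈⟨ difference-interchange a c b d ⟩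
    (a - b) - (c - d)  ≈⟨ x≈y⇒x∙y⁻¹≈ε a-b≈c-d ⟩
    ε                  ∎)
    where open SetoidReasoning setoid

  difference : Carrier × Carrier → Carrier
  difference (x , y) = x - y

  firsts : List (Carrier × Carrier) → List Carrier
  firsts = map proj₁

  DistinctPairs : List (Carrier × Carrier) → Set
  DistinctPairs = AllPairs (λ p p' → ¬ (proj₁ p ≈ proj₁ p' × proj₂ p ≈ proj₂ p'))

  module ConstantDifference {g : Carrier} {F : List (Carrier × Carrier)}
                            (difference≈g : All (λ p → difference p ≈ g) F) where

    first-difference≈second-difference : ∀ {p p'} → p ∈ F → p' ∈ F →
      proj₁ p - proj₁ p' ≈ proj₂ p - proj₂ p'
    first-difference≈second-difference p∈F p'∈F =
      x-y≈u-v⇒x-u≈y-v (trans (All.lookup difference≈g p∈F) (sym (All.lookup difference≈g p'∈F)))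

    firsts-distinct : DistinctPairs F → AllPairs (λ x y → ¬ x ≈ y) (firsts F)
    firsts-distinct distinct =
      AllPairs.map⁺ (AllPairs-map-All same-first⇒same-pair (All.tabulate (λ p∈F → p∈F)) distinct)
      where
      same-first⇒same-pair : ∀ {p p'} → p ∈ F → p' ∈ F →
        ¬ (proj₁ p ≈ proj₁ p' × proj₂ p ≈ proj₂ p') → ¬ proj₁ p ≈ proj₁ p'
      same-first⇒same-pair p∈F p'∈F p≉p' x≈x' = p≉p' (x≈x' , x∙y⁻¹≈ε⇒x≈y _ _
        (trans (sym (first-difference≈second-difference p∈F p'∈F)) (x≈y⇒x∙y⁻¹≈ε x≈x')))

    firsts-separate : ∀ {A₁ A₂ bs₁ bs₂} → Separates A₁ bs₁ → Separates A₂ bs₂ →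
      All (λ p → proj₁ p ∈ bs₁ × proj₂ p ∈ bs₂) F → Separates (_∪_ G A₁ A₂) (firsts F)
    firsts-separate {A₂ = A₂} sep₁ sep₂ inB c∈ c'∈ c-c'∈A₁∪A₂
      with ∈-map⁻ proj₁ c∈ | ∈-map⁻ proj₁ c'∈
    ... | p , p∈F , ≡.refl | p' , p'∈F , ≡.refl
      with All.lookup inB p∈F | All.lookup inB p'∈F | c-c'∈A₁∪A₂
    ... | x∈ , _ | x'∈ , _ | inj₁ x-x'∈A₁ = sep₁ x∈ x'∈ x-x'∈A₁
    ... | _ , y∈ | _ , y'∈ | inj₂ x-x'∈A₂ =
      trans x-x'≈y-y' (sep₂ y∈ y'∈ (respect A₂ x-x'≈y-y' x-x'∈A₂))
      where x-x'≈y-y' = first-difference≈second-difference p∈F p'∈F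

  module _ {A₁ A₂ : Subset G} {n : ℕ} (0∈A₁ : mem A₁ ε)
           (maximal : ∀ B → Avoids G (_∪_ G A₁ A₂) B → length (elems B) ≤ n)
           (B₁ B₂ : FinSubset G) (sep₁ : Separates A₁ (elems B₁)) (sep₂ : Separates A₂ (elems B₂)) where

    InB₁×B₂ : Carrier × Carrier → Set
    InB₁×B₂ (x , y) = x ∈ elems B₁ × y ∈ elems B₂

    constant-difference-length≤ : ∀ {g p ps} → All (λ p → difference p ≈ g) (p ∷ ps) →
      All InB₁×B₂ (p ∷ ps) → DistinctPairs (p ∷ ps) → length (p ∷ ps) ≤ n
    constant-difference-length≤ {p = p} {ps} difference≈g inB distinct = begin
      length (p ∷ ps)           ≡⟨ length-map proj₁ (p ∷ ps) ⟨
      length (firsts (p ∷ ps))  ≤⟨ maximal C C-avoids ⟩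
      n                         ∎
      where
      open ≤-Reasoning
      open ConstantDifference difference≈g
      C : FinSubset G
      C = record { elems = firsts (p ∷ ps) ; distinct = firsts-distinct distinct }
      C-avoids : Avoids G (_∪_ G A₁ A₂) C
      C-avoids = separates⇒avoids {_∪_ G A₁ A₂} {C} (inj₁ 0∈A₁) (here ≡.refl)
                   (firsts-separate {A₁} {A₂} sep₁ sep₂ inB)

    label : Carrier × Carrier → ℕ
    label p = toℕ (Inverse.from enum (difference p))

    equally-labelled-length≤ : ∀ {i} F → All (λ p → label p ≡ i) F →
      All InB₁×B₂ F → DistinctPairs F → length F ≤ n
    equally-labelled-length≤ [] _ _ _ = z≤n
    equally-labelled-length≤ {i} (p ∷ ps) labels =
      constant-difference-length≤ (All.map same-label⇒same-difference labels)
      where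
      same-label⇒same-difference : ∀ {p'} → label p' ≡ i → difference p' ≈ difference p
      same-label⇒same-difference e =
        enum-from-injective (toℕ-injective (≡.trans e (≡.sym (All.head labels))))

    pairs : List (Carrier × Carrier)
    pairs = cartesianProduct (elems B₁) (elems B₂)

    fibre-length≤ : ∀ i → length (fibre label i pairs) ≤ n
    fibre-length≤ i = equally-labelled-length≤ (fibre label i pairs)
      (All.all-filter _ pairs)
      (All.filter⁺ _ (All.tabulate (∈-cartesianProduct⁻ (elems B₁) (elems B₂))))
      (AllPairs.filter⁺ _ (Unique.cartesianProduct⁺ setoid setoid (distinct B₁) (distinct B₂)))

    product-length≤ : length (elems B₁) * length (elems B₂) ≤ q * n
    product-length≤ = begin
      length (elems B₁) * length (elems B₂)  ≡⟨ length-cartesianProduct (elems B₁) (elems B₂) ⟨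
      length pairs                           ≤⟨ fibres-bound-length label q n pairs
                                                  (All.tabulate (λ _ → toℕ<n _)) fibre-length≤ ⟩
      q * n                                  ∎
      where open ≤-Reasoning

-- Standardness is used only through 0 ∈ A₁: Avoids also asks for a difference
-- lying in A, so only nonempty sets are admissible.
theorem6p2 : (G : FiniteAbelianGroup) (A₁ A₂ : Subset G) →
    Standard G A₁ → Standard G A₂ →
    (n₁ n₂ n : ℕ) → IsΔ G A₁ n₁ → IsΔ G A₂ n₂ → IsΔ G (_∪_ G A₁ A₂) n →
    n₁ * n₂ ≤ n * FiniteAbelianGroup.q G
theorem6p2 G A₁ A₂ A₁-standard _ _ _ n
  ((B₁ , (sep₁ , _) , ≡.refl) , _) ((B₂ , (sep₂ , _) , ≡.refl) , _) (_ , maximal) =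
  ≤-trans (product-length≤ G {A₁} {A₂} (Standard.zero∈ A₁-standard) maximal B₁ B₂ sep₁ sep₂)
          (≤-reflexive (*-comm (FiniteAbelianGroup.q G) n))
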